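{- Let $\mathbf L=(L,\vee,\wedge,0,1)$ be a complemented lattice and $\Phi$ an equivalence relation on $L$ having the Substitution Property with respect to $\to$. Then: (i) $\Phi$ has the Substitution Property with respect to $^+$; (ii) $[1]\Phi$ is a deductive system of $\mathbf L$; (iii) $\Phi\subseteq\Theta([1]\Phi)$.
   Context: A bounded lattice is complemented if every element $a$ has some $b$ with $a\vee b=1$, $a\wedge b=0$ (complements need not be unique); lattices are non-trivial. For $a\in L$, $a^+:=\{x\in L\mid a\vee x=1,\ a\wedge x=0\}$, and $a\to b:=\{x\vee(a\wedge b)\mid x\in a^+\}$. An equivalence relation $\Phi$ on $L$ has the Substitution Property with respect to $^+$ if $(a,b)\in\Phi$ implies $a^+\times b^+\subseteq\Phi$, and with respect to $\to$ if $(a,b)\in\Phi$ implies $(a\to c)\times(b\to c)\subseteq\Phi$ for all $c\in L$. A deductive system of $\mathbf L$ is a subset $D\subseteq L$ with $1\in D$ such that whenever $a\in D$, $b\in L$ and $a\to b\subseteq D$, then $b\in D$. For a deductive system $D$, $\Theta(D):=\{(x,y)\in L^2\mid x\to y\subseteq D\text{ and }y\to x\subseteq D\}$. $[1]\Phi$ is the $\Phi$-class of $1$. -}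

module Defs where

open import Level using (Level; _⊔_; suc)
open import Data.Product using (Σ; _×_; ∃-syntax)
open import Relation.Nullary using (¬_)
open import Relation.Binary using (Rel; IsEquivalence)
open import Relation.Binary.Lattice.Bundles using (BoundedLattice)

module _ {c ℓ₁ ℓ₂ : Level} (L : BoundedLattice c ℓ₁ ℓ₂) where
  open BoundedLattice L

  Subset : (ℓ : Level) → Set (c ⊔ suc ℓ)
  Subset ℓ = Carrier → Set ℓ

  _⁺ : Carrier → Subset ℓ₁
  (a ⁺) x = ((a ∨ x) ≈ ⊤) × ((a ∧ x) ≈ ⊥)

  _⇒_ : Carrier → Carrier → Subset (c ⊔ ℓ₁)
  (a ⇒ b) y = ∃[ x ] ((a ⁺) x × (y ≈ (x ∨ (a ∧ b))))

  IsComplemented : Set (c ⊔ ℓ₁)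
  IsComplemented = ∀ a → ∃[ b ] (a ⁺) b

  NonTrivial : Set ℓ₁
  NonTrivial = ¬ (⊤ ≈ ⊥)

  _⊆_ : ∀ {ℓ ℓ'} → Subset ℓ → Subset ℓ' → Set (c ⊔ ℓ ⊔ ℓ')
  A ⊆ B = ∀ {x} → A x → B x

  _×_⊆R_ : ∀ {ℓ ℓ' ℓΦ} → Subset ℓ → Subset ℓ' → Rel Carrier ℓΦ → Set (c ⊔ ℓ ⊔ ℓ' ⊔ ℓΦ)
  A × B ⊆R Φ = ∀ {x y} → A x → B y → Φ x y

  -- An equivalence relation on (the set) L: an equivalence containing the
  -- underlying equality ≈ of the carrier setoid.
  record IsEquivOn {ℓΦ : Level} (Φ : Rel Carrier ℓΦ) : Set (c ⊔ ℓ₁ ⊔ ℓΦ) where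
    field
      isEquivalence : IsEquivalence Φ
      ≈⇒Φ : ∀ {x y} → x ≈ y → Φ x y

  SP⁺ : ∀ {ℓΦ} → Rel Carrier ℓΦ → Set (c ⊔ ℓ₁ ⊔ ℓΦ)
  SP⁺ Φ = ∀ {a b} → Φ a b → (a ⁺) × (b ⁺) ⊆R Φ

  SP⇒ : ∀ {ℓΦ} → Rel Carrier ℓΦ → Set (c ⊔ ℓ₁ ⊔ ℓΦ)
  SP⇒ Φ = ∀ {a b} → Φ a b → ∀ c' → (a ⇒ c') × (b ⇒ c') ⊆R Φ

  IsDeductiveSystem : ∀ {ℓ} → Subset ℓ → Set (c ⊔ ℓ₁ ⊔ ℓ)
  IsDeductiveSystem D = D ⊤ × (∀ a b → D a → (a ⇒ b) ⊆ D → D b)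

  Θ : ∀ {ℓ} → Subset ℓ → Rel Carrier (c ⊔ ℓ₁ ⊔ ℓ)
  Θ D x y = ((x ⇒ y) ⊆ D) × ((y ⇒ x) ⊆ D)

  [1]_ : ∀ {ℓΦ} → Rel Carrier ℓΦ → Subset ℓΦ
  ([1] Φ) x = Φ ⊤ x

  _⊆₂_ : ∀ {ℓ ℓ'} → Rel Carrier ℓ → Rel Carrier ℓ' → Set (c ⊔ ℓ ⊔ ℓ')
  R ⊆₂ S = ∀ {x y} → R x y → S x y

{-# OPTIONS --safe #-}
module Submission where

-- The three parts are instances of the substitution property at well-chosen
-- arguments. For (i) take c = 0: then x ∨ (a ∧ 0) = x, so a → 0 contains a⁺.
-- For (ii) compare a → b with 1 → b, which contains b (witness 0 ∈ 1⁺).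
-- For (iii) compare x → y with y → y, which contains 1 (any complement of y).

open import Defs
open import Level using (Level)
open import Data.Product using (_×_; _,_; ∃)
open import Relation.Binary using (Rel; IsEquivalence)
open import Relation.Binary.Lattice.Bundles using (BoundedLattice)
import Relation.Binary.Lattice.Properties.BoundedLattice as BoundedLatticeProperties
import Relation.Binary.Lattice.Properties.BoundedJoinSemilattice as BoundedJoinProperties
import Relation.Binary.Lattice.Properties.JoinSemilattice as JoinProperties
import Relation.Binary.Lattice.Properties.MeetSemilattice as MeetProperties
import Relation.Binary.Reasoning.Setoid as SetoidReasoning

module _ {c ℓ₁ ℓ₂ : Level} (L : BoundedLattice c ℓ₁ ℓ₂) where
  open BoundedLattice L
  open BoundedLatticeProperties L using (∧-zeroʳ; ∨-zeroˡ)
  open BoundedJoinProperties boundedJoinSemilattice using (identityˡ; identityʳ)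
  open JoinProperties joinSemilattice using (∨-cong; ∨-comm)
  open MeetProperties meetSemilattice using (∧-idempotent; y≤x⇒x∧y≈y)

  ⁺⊆⇒⊥ : ∀ a → _⊆_ L (_⁺ L a) (_⇒_ L a ⊥)
  ⁺⊆⇒⊥ a {x} x∈a⁺ = x , x∈a⁺ , Eq.sym (begin
    x ∨ (a ∧ ⊥) ≈⟨ ∨-cong Eq.refl (∧-zeroʳ a) ⟩
    x ∨ ⊥       ≈⟨ identityʳ x ⟩
    x           ∎)
    where open SetoidReasoning setoid

  b∈⊤⇒b : ∀ b → _⇒_ L ⊤ b b
  b∈⊤⇒b b = ⊥ , (∨-zeroˡ ⊥ , ∧-zeroʳ ⊤) , Eq.sym (begin
    ⊥ ∨ (⊤ ∧ b) ≈⟨ ∨-cong Eq.refl (y≤x⇒x∧y≈y (maximum b)) ⟩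
    ⊥ ∨ b       ≈⟨ identityˡ b ⟩
    b           ∎)
    where open SetoidReasoning setoid

  ⇒-inhabited : IsComplemented L → ∀ a b → ∃ (_⇒_ L a b)
  ⇒-inhabited complemented a b with complemented a
  ... | a′ , a′∈a⁺ = a′ ∨ (a ∧ b) , a′ , a′∈a⁺ , Eq.refl

  ⊤∈a⇒a : IsComplemented L → ∀ a → _⇒_ L a a ⊤
  ⊤∈a⇒a complemented a with complemented a
  ... | a′ , a′∈a⁺@(a∨a′≈⊤ , _) = a′ , a′∈a⁺ , Eq.sym (begin
    a′ ∨ (a ∧ a) ≈⟨ ∨-cong Eq.refl (∧-idempotent a) ⟩
    a′ ∨ a       ≈⟨ ∨-comm a′ a ⟩
    a ∨ a′       ≈⟨ a∨a′≈⊤ ⟩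
    ⊤            ∎)
    where open SetoidReasoning setoid

  module _ {ℓΦ : Level} {Φ : Rel Carrier ℓΦ} (sp⇒ : SP⇒ L Φ) where

    SP⇒⇒SP⁺ : SP⁺ L Φ
    SP⇒⇒SP⁺ Φab x∈a⁺ y∈b⁺ = sp⇒ Φab ⊥ (⁺⊆⇒⊥ _ x∈a⁺) (⁺⊆⇒⊥ _ y∈b⁺)

    module _ (isEquivalence : IsEquivalence Φ) (complemented : IsComplemented L) where
      open IsEquivalence isEquivalence renaming (refl to Φ-refl; sym to Φ-sym; trans to Φ-trans)

      SP⇒⇒[1]-isDeductiveSystem : IsDeductiveSystem L (([1]_) L Φ)
      SP⇒⇒[1]-isDeductiveSystem = Φ-refl , closed
        where
        closed : ∀ a b → Φ ⊤ a → _⊆_ L (_⇒_ L a b) (([1]_) L Φ) → Φ ⊤ b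
        closed a b Φ⊤a a⇒b⊆[1] with ⇒-inhabited complemented a b
        ... | z , z∈a⇒b = Φ-trans (a⇒b⊆[1] z∈a⇒b) (sp⇒ (Φ-sym Φ⊤a) b z∈a⇒b (b∈⊤⇒b b))

      x⇒y⊆[1] : ∀ {x y} → Φ x y → _⊆_ L (_⇒_ L x y) (([1]_) L Φ)
      x⇒y⊆[1] {y = y} Φxy z∈x⇒y = Φ-sym (sp⇒ Φxy y z∈x⇒y (⊤∈a⇒a complemented y))

      SP⇒⇒⊆Θ[1] : _⊆₂_ L Φ (Θ L (([1]_) L Φ))
      SP⇒⇒⊆Θ[1] Φxy = x⇒y⊆[1] Φxy , x⇒y⊆[1] (Φ-sym Φxy)

theorem5p8 : {c ℓ₁ ℓ₂ ℓΦ : Level} (L : BoundedLattice c ℓ₁ ℓ₂)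
    → NonTrivial L → IsComplemented L
    → (Φ : Rel (BoundedLattice.Carrier L) ℓΦ) → IsEquivOn L Φ → SP⇒ L Φ
    → SP⁺ L Φ × IsDeductiveSystem L (([1]_) L Φ) × _⊆₂_ L Φ (Θ L (([1]_) L Φ))
theorem5p8 L _ complemented Φ equivOn sp⇒ =
    SP⇒⇒SP⁺ L sp⇒
  , SP⇒⇒[1]-isDeductiveSystem L sp⇒ isEquivalence complemented
  , SP⇒⇒⊆Θ[1] L sp⇒ isEquivalence complemented
  where open IsEquivOn equivOn using (isEquivalence)
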